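{- Let $G$ be a finite simple graph without isolated vertices and let $f=(V_0,V_1,V_2)$ be a $\gamma_{tR}(G)$-function. Then $$\gamma_{tR}(G)\ge |V(G)|-(\Delta(G)-2)|V_2| \quad\text{and}\quad |V_2|\ge \frac{|V(G)|-|V_1|}{\Delta(G)}.$$ Moreover, if $|V(G)|=\Delta(G)|V_2|+|V_1|$, then $\gamma_{tR}(G)=|V(G)|-(\Delta(G)-2)|V_2|$.
   Context: $\Delta(G)$ is the maximum degree of $G$. A function $f:V(G)\to\{0,1,2\}$ with $V_i=f^{ -1}(i)$ is a total Roman dominating function if every vertex in $V_0$ has a neighbor in $V_2$ and the subgraph induced by $V_1\cup V_2$ has no isolated vertices; $\gamma_{tR}(G)$ is the minimum of $\sum_v f(v)$ over such $f$, and a $\gamma_{tR}(G)$-function is one attaining this minimum. -}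

module Defs where

open import Data.Nat using (ℕ; zero; suc; _+_; _*_; _≤_; _⊔_)
open import Data.Fin using (Fin)
open import Data.Bool using (Bool; true; false; T)
open import Data.List using (List; length; filter; map; foldr)
open import Data.Nat.ListAction using (sum)
open import Data.List using () renaming (allFin to allFinL)
open import Data.Product using (Σ; ∃; _×_; _,_)
open import Relation.Binary.PropositionalEquality using (_≡_)
open import Relation.Nullary using (¬_)
open import Relation.Nullary.Decidable using (does)
open import Data.Fin using (_≟_)

record Graph (n : ℕ) : Set where
  field
    adj   : Fin n → Fin n → Bool
    sym   : ∀ u v → adj u v ≡ adj v u
    irrefl : ∀ v → adj v v ≡ false
open Graph public

vertices : (n : ℕ) → List (Fin n)
vertices n = allFinL n

Adj : ∀ {n} → Graph n → Fin n → Fin n → Set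
Adj G u v = T (adj G u v)

degree : ∀ {n} → Graph n → Fin n → ℕ
degree {n} G v = length (filter (λ u → Data.Bool.T? (adj G v u)) (vertices n))
  where import Data.Bool

maxDegree : ∀ {n} → Graph n → ℕ
maxDegree {n} G = foldr (λ v m → degree G v ⊔ m) 0 (vertices n)

NoIsolated : ∀ {n} → Graph n → Set
NoIsolated {n} G = ∀ v → ∃ λ u → Adj G v u

Labelling : ℕ → Set
Labelling n = Fin n → Fin 3

weight : ∀ {n} → Labelling n → ℕ
weight {n} f = sum (map (λ v → Data.Fin.toℕ (f v)) (vertices n))

classSize : ∀ {n} → Labelling n → Fin 3 → ℕ
classSize {n} f i = length (filter (λ v → f v ≟ i) (vertices n))

IsTRDF : ∀ {n} → Graph n → Labelling n → Set
IsTRDF {n} G f =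
  (∀ v → f v ≡ Data.Fin.zero →
      ∃ λ u → Adj G v u × f u ≡ Data.Fin.suc (Data.Fin.suc Data.Fin.zero))
  × (∀ v → ¬ (f v ≡ Data.Fin.zero) →
      ∃ λ u → Adj G v u × ¬ (f u ≡ Data.Fin.zero))

IsGammaTRFunction : ∀ {n} → Graph n → Labelling n → Set
IsGammaTRFunction G f = IsTRDF G f × (∀ g → IsTRDF G g → weight f ≤ weight g)

module Submission where

-- Let f = (V₀, V₁, V₂) be a total
-- Roman dominating function.
-- The heart of the proof is a double count of the edges between V₀ and V₂:
--   * every vertex of V₀ has a neighbour in V₂, so |V₀| ≤ #edges(V₀, V₂);
--   * every vertex u of V₂ has a neighbour outside V₀ (V₁ ∪ V₂ induces no
--     isolated vertex), so u has at most Δ - 1 neighbours in V₀ and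
--     #edges(V₀, V₂) ≤ (Δ - 1)|V₂|.
-- Hence |V₀| + |V₂| ≤ Δ|V₂|, and adding |V₁| gives n ≤ Δ|V₂| + |V₁|, which is
-- the second claim.  Since w(f) = |V₁| + 2|V₂|, subtracting (Δ - 2)|V₂| from
-- both sides of this inequality gives the first claim, and in the equality
-- case the same computation is an identity, giving the third claim.

open import Defs
open import Data.Nat using (ℕ; _≤_; _*_; _+_)
open import Data.Fin using (zero; suc)
open import Data.Integer using (ℤ; +_; _-_) renaming (_*_ to _*ℤ_; _≤_ to _≤ℤ_)
open import Data.Product using (_×_)
open import Relation.Binary.PropositionalEquality using (_≡_)

open import Data.Nat using (_⊔_; z≤n)
import Data.Nat.Properties as ℕₚ
open import Data.Nat.Tactic.RingSolver using (solve-∀)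
import Data.Integer as ℤ
import Data.Integer.Properties as ℤₚ
import Data.Integer.Tactic.RingSolver as ℤ-Ring
open import Algebra.Properties.CommutativeSemigroup ℕₚ.+-commutativeSemigroup
  using (interchange)
open import Data.Fin using (Fin; toℕ; _≟_)
open import Data.Bool using (T?)
open import Data.List using (List; []; _∷_; length; filter; map; foldr)
open import Data.Nat.ListAction using (sum)
open import Data.List.Relation.Unary.Any using (here; there)
open import Data.List.Membership.Propositional using (_∈_)
open import Data.List.Membership.Propositional.Properties using (∈-allFin)
open import Data.List.Properties using (length-tabulate)
open import Data.Product using (_,_; proj₁; proj₂)
open import Relation.Nullary using (Dec; yes; no; ¬_; contradiction)
open import Relation.Binary.PropositionalEquality
  using (refl; trans; cong; cong₂; subst; module ≡-Reasoning)
import Relation.Binary.PropositionalEquality as ≡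

∑ : {A : Set} → List A → (A → ℕ) → ℕ
∑ xs g = sum (map g xs)

module _ {A : Set} where

  ∑-cong : (xs : List A) {g h : A → ℕ} → (∀ x → g x ≡ h x) → ∑ xs g ≡ ∑ xs h
  ∑-cong []       g≡h = refl
  ∑-cong (x ∷ xs) g≡h = cong₂ _+_ (g≡h x) (∑-cong xs g≡h)

  ∑-mono : (xs : List A) {g h : A → ℕ} → (∀ x → g x ≤ h x) → ∑ xs g ≤ ∑ xs h
  ∑-mono []       g≤h = z≤n
  ∑-mono (x ∷ xs) g≤h = ℕₚ.+-mono-≤ (g≤h x) (∑-mono xs g≤h)

  ∑-+ : (xs : List A) (g h : A → ℕ) → ∑ xs (λ x → g x + h x) ≡ ∑ xs g + ∑ xs h
  ∑-+ []       g h = refl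
  ∑-+ (x ∷ xs) g h =
    trans (cong (_+_ (g x + h x)) (∑-+ xs g h)) (interchange (g x) (h x) (∑ xs g) (∑ xs h))

  ∑-*ˡ : (xs : List A) (k : ℕ) (g : A → ℕ) → ∑ xs (λ x → k * g x) ≡ k * ∑ xs g
  ∑-*ˡ []       k g = ≡.sym (ℕₚ.*-zeroʳ k)
  ∑-*ˡ (x ∷ xs) k g =
    trans (cong (_+_ (k * g x)) (∑-*ˡ xs k g)) (≡.sym (ℕₚ.*-distribˡ-+ k (g x) (∑ xs g)))

  ∑-zero : (xs : List A) → ∑ xs (λ _ → 0) ≡ 0
  ∑-zero []       = refl
  ∑-zero (_ ∷ xs) = ∑-zero xs

  ∑-one : (xs : List A) → ∑ xs (λ _ → 1) ≡ length xs
  ∑-one []       = refl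
  ∑-one (_ ∷ xs) = cong (_+_ 1) (∑-one xs)

  term≤∑ : {xs : List A} {x : A} (g : A → ℕ) → x ∈ xs → g x ≤ ∑ xs g
  term≤∑ g (here refl)            = ℕₚ.m≤m+n _ _
  term≤∑ {y ∷ _} g (there x∈xs) = ℕₚ.≤-trans (term≤∑ g x∈xs) (ℕₚ.m≤n+m _ (g y))

  term≤max : {xs : List A} {x : A} (g : A → ℕ) → x ∈ xs →
             g x ≤ foldr (λ y m → g y ⊔ m) 0 xs
  term≤max g (here refl)            = ℕₚ.m≤m⊔n _ _
  term≤max {y ∷ _} g (there x∈xs) = ℕₚ.≤-trans (term≤max g x∈xs) (ℕₚ.m≤n⊔m (g y) _)

∑-comm : {A B : Set} (xs : List A) (ys : List B) (h : A → B → ℕ) →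
         ∑ xs (λ x → ∑ ys (h x)) ≡ ∑ ys (λ y → ∑ xs (λ x → h x y))
∑-comm []       ys h = ≡.sym (∑-zero ys)
∑-comm (x ∷ xs) ys h =
  trans (cong (_+_ (∑ ys (h x))) (∑-comm xs ys h)) (≡.sym (∑-+ ys (h x) (λ y → ∑ xs (λ x → h x y))))

𝟙 : {P : Set} → Dec P → ℕ
𝟙 (yes _) = 1
𝟙 (no _)  = 0

length-filter≡∑ : {A : Set} {P : A → Set} (P? : ∀ x → Dec (P x)) (xs : List A) →
                  length (filter P? xs) ≡ ∑ xs (λ x → 𝟙 (P? x))
length-filter≡∑ P? []       = refl
length-filter≡∑ P? (x ∷ xs) with P? x
... | yes _ = cong (_+_ 1) (length-filter≡∑ P? xs)
... | no _  = length-filter≡∑ P? xs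

-- Double counting with a symmetric kernel a: weighting the a-neighbourhood
-- sums of q by p equals weighting the a-neighbourhood sums of p by q.
-- (With a the adjacency matrix, both sides count edges between p and q.)
double-count : {A : Set} (xs : List A) (a : A → A → ℕ) → (∀ u v → a u v ≡ a v u) →
               (p q : A → ℕ) →
               ∑ xs (λ v → p v * ∑ xs (λ u → a v u * q u))
               ≡ ∑ xs (λ u → q u * ∑ xs (λ v → a u v * p v))
double-count xs a a-sym p q = begin
    ∑ xs (λ v → p v * ∑ xs (λ u → a v u * q u))
  ≡⟨ ∑-cong xs (λ v → ≡.sym (∑-*ˡ xs (p v) (λ u → a v u * q u))) ⟩
    ∑ xs (λ v → ∑ xs (λ u → p v * (a v u * q u)))
  ≡⟨ ∑-comm xs xs _ ⟩
    ∑ xs (λ u → ∑ xs (λ v → p v * (a v u * q u)))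
  ≡⟨ ∑-cong xs (λ u → ∑-cong xs (λ v → reorder u v)) ⟩
    ∑ xs (λ u → ∑ xs (λ v → q u * (a u v * p v)))
  ≡⟨ ∑-cong xs (λ u → ∑-*ˡ xs (q u) (λ v → a u v * p v)) ⟩
    ∑ xs (λ u → q u * ∑ xs (λ v → a u v * p v)) ∎
  where
  open ≡-Reasoning
  reorder : ∀ u v → p v * (a v u * q u) ≡ q u * (a u v * p v)
  reorder u v rewrite a-sym v u = outer-swap (p v) (a u v) (q u)
    where
    outer-swap : ∀ x y z → x * (y * z) ≡ z * (y * x)
    outer-swap = solve-∀

module TRDFCounting {n : ℕ} (G : Graph n) (f : Labelling n) (trdf : IsTRDF G f) where

  vs : List (Fin n)
  vs = vertices n

  Δ : ℕ
  Δ = maxDegree G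

  L₀ L₁ L₂ : Fin 3
  L₀ = zero
  L₁ = suc zero
  L₂ = suc (suc zero)

  c : Fin 3 → ℕ
  c = classSize f

  χ : Fin 3 → Fin n → ℕ
  χ i v = 𝟙 (f v ≟ i)

  a : Fin n → Fin n → ℕ
  a u v = 𝟙 (T? (adj G u v))

  a-sym : ∀ u v → a u v ≡ a v u
  a-sym u v rewrite Graph.sym G u v = refl

  N : Fin 3 → Fin n → ℕ
  N i v = ∑ vs (λ u → a v u * χ i u)

  c≡∑χ : ∀ i → c i ≡ ∑ vs (χ i)
  c≡∑χ i = length-filter≡∑ (λ v → f v ≟ i) vs

  degree≡∑a : ∀ u → degree G u ≡ ∑ vs (a u)
  degree≡∑a u = length-filter≡∑ (λ v → T? (adj G u v)) vs

  degree≤Δ : ∀ u → degree G u ≤ Δ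
  degree≤Δ u = term≤max (degree G) (∈-allFin u)

  adj⇒a≡1 : ∀ {u v} → Adj G u v → a u v ≡ 1
  adj⇒a≡1 {u} {v} u~v with T? (adj G u v)
  ... | yes _    = refl
  ... | no ¬u~v = contradiction u~v ¬u~v

  χ-partition : ∀ v → χ L₀ v + χ L₁ v + χ L₂ v ≡ 1
  χ-partition v with f v
  ... | zero           = refl
  ... | suc zero       = refl
  ... | suc (suc zero) = refl

  χ-label : ∀ v → toℕ (f v) ≡ χ L₁ v + 2 * χ L₂ v
  χ-label v with f v
  ... | zero           = refl
  ... | suc zero       = refl
  ... | suc (suc zero) = refl

  χ-positive : ∀ v → ¬ f v ≡ L₀ → χ L₁ v + χ L₂ v ≡ 1
  χ-positive v fv≢0 with f v
  ... | zero           = contradiction refl fv≢0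
  ... | suc zero       = refl
  ... | suc (suc zero) = refl

  χ-own : ∀ {v} i → f v ≡ i → χ i v ≡ 1
  χ-own {v} i fv≡i with f v ≟ i
  ... | yes _    = refl
  ... | no fv≢i = contradiction fv≡i fv≢i

  order-split : n ≡ c L₀ + c L₁ + c L₂
  order-split = begin
      n
    ≡⟨ ≡.sym (length-tabulate {n = n} (λ v → v)) ⟩
      length vs
    ≡⟨ ≡.sym (∑-one vs) ⟩
      ∑ vs (λ _ → 1)
    ≡⟨ ≡.sym (∑-cong vs χ-partition) ⟩
      ∑ vs (λ v → χ L₀ v + χ L₁ v + χ L₂ v)
    ≡⟨ ∑-+ vs _ (χ L₂) ⟩
      ∑ vs (λ v → χ L₀ v + χ L₁ v) + ∑ vs (χ L₂)
    ≡⟨ cong (_+ ∑ vs (χ L₂)) (∑-+ vs (χ L₀) (χ L₁)) ⟩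
      ∑ vs (χ L₀) + ∑ vs (χ L₁) + ∑ vs (χ L₂)
    ≡⟨ ≡.sym (cong₂ _+_ (cong₂ _+_ (c≡∑χ L₀) (c≡∑χ L₁)) (c≡∑χ L₂)) ⟩
      c L₀ + c L₁ + c L₂ ∎
    where open ≡-Reasoning

  weight-split : weight f ≡ c L₁ + 2 * c L₂
  weight-split = begin
      ∑ vs (λ v → toℕ (f v))
    ≡⟨ ∑-cong vs χ-label ⟩
      ∑ vs (λ v → χ L₁ v + 2 * χ L₂ v)
    ≡⟨ ∑-+ vs (χ L₁) _ ⟩
      ∑ vs (χ L₁) + ∑ vs (λ v → 2 * χ L₂ v)
    ≡⟨ cong₂ _+_ (≡.sym (c≡∑χ L₁)) (trans (∑-*ˡ vs 2 (χ L₂)) (cong (2 *_) (≡.sym (c≡∑χ L₂)))) ⟩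
      c L₁ + 2 * c L₂ ∎
    where open ≡-Reasoning

  neighbour-split : ∀ u v → a u v ≡ a u v * χ L₀ v + a u v * (χ L₁ v + χ L₂ v)
  neighbour-split u v = begin
      a u v
    ≡⟨ ≡.sym (ℕₚ.*-identityʳ (a u v)) ⟩
      a u v * 1
    ≡⟨ cong (a u v *_) (trans (≡.sym (χ-partition v)) (ℕₚ.+-assoc (χ L₀ v) _ _)) ⟩
      a u v * (χ L₀ v + (χ L₁ v + χ L₂ v))
    ≡⟨ ℕₚ.*-distribˡ-+ (a u v) (χ L₀ v) _ ⟩
      a u v * χ L₀ v + a u v * (χ L₁ v + χ L₂ v) ∎
    where open ≡-Reasoning

  -- A vertex of V₂ has a neighbour outside V₀, hence at most Δ - 1
  -- neighbours in V₀.
  V₂-few-V₀-neighbours : ∀ u → f u ≡ L₂ → N L₀ u + 1 ≤ Δ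
  V₂-few-V₀-neighbours u fu≡2 = begin
      N L₀ u + 1
    ≤⟨ ℕₚ.+-monoʳ-≤ (N L₀ u) one-positive-neighbour ⟩
      N L₀ u + ∑ vs (λ v → a u v * (χ L₁ v + χ L₂ v))
    ≡⟨ ≡.sym (∑-+ vs _ _) ⟩
      ∑ vs (λ v → a u v * χ L₀ v + a u v * (χ L₁ v + χ L₂ v))
    ≡⟨ ≡.sym (∑-cong vs (neighbour-split u)) ⟩
      ∑ vs (a u)
    ≡⟨ ≡.sym (degree≡∑a u) ⟩
      degree G u
    ≤⟨ degree≤Δ u ⟩
      Δ ∎
    where
    open ℕₚ.≤-Reasoning
    fu≢0 : ¬ f u ≡ L₀
    fu≢0 fu≡0 with trans (≡.sym fu≡0) fu≡2
    ... | ()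
    positive-neighbour : Fin n → ℕ
    positive-neighbour v = a u v * (χ L₁ v + χ L₂ v)
    one-positive-neighbour : 1 ≤ ∑ vs positive-neighbour
    one-positive-neighbour with proj₂ trdf u fu≢0
    ... | w , u~w , fw≢0 =
      subst (_≤ ∑ vs positive-neighbour) (cong₂ _*_ (adj⇒a≡1 u~w) (χ-positive w fw≢0))
        (term≤∑ positive-neighbour (∈-allFin w))

  -- Every vertex of V₀ has a neighbour in V₂:  [v ∈ V₀] ≤ [v ∈ V₀]·|N(v) ∩ V₂|.
  V₀-dominated : ∀ v → χ L₀ v ≤ χ L₀ v * N L₂ v
  V₀-dominated v with f v ≟ L₀
  ... | no _    = z≤n
  ... | yes fv≡0 with proj₁ trdf v fv≡0
  ...   | u , v~u , fu≡2 = begin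
      1               ≡⟨ ≡.sym (cong₂ _*_ (adj⇒a≡1 v~u) (χ-own L₂ fu≡2)) ⟩
      a v u * χ L₂ u  ≤⟨ term≤∑ (λ u → a v u * χ L₂ u) (∈-allFin u) ⟩
      N L₂ v          ≡⟨ ≡.sym (ℕₚ.*-identityˡ (N L₂ v)) ⟩
      1 * N L₂ v      ∎
    where open ℕₚ.≤-Reasoning

  V₂-bounded : ∀ u → χ L₂ u * N L₀ u + χ L₂ u ≤ χ L₂ u * Δ
  V₂-bounded u with f u ≟ L₂
  ... | no _     = z≤n
  ... | yes fu≡2 = begin
      1 * N L₀ u + 1  ≡⟨ cong (_+ 1) (ℕₚ.*-identityˡ (N L₀ u)) ⟩
      N L₀ u + 1      ≤⟨ V₂-few-V₀-neighbours u fu≡2 ⟩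
      Δ               ≡⟨ ≡.sym (ℕₚ.*-identityˡ Δ) ⟩
      1 * Δ           ∎
    where open ℕₚ.≤-Reasoning

  -- Double counting the edges between V₀ and V₂:  |V₀| + |V₂| ≤ Δ|V₂|.
  V₀+V₂≤Δ·V₂ : c L₀ + c L₂ ≤ Δ * c L₂
  V₀+V₂≤Δ·V₂ = begin
      c L₀ + c L₂
    ≡⟨ cong₂ _+_ (c≡∑χ L₀) (c≡∑χ L₂) ⟩
      ∑ vs (χ L₀) + ∑ vs (χ L₂)
    ≤⟨ ℕₚ.+-monoˡ-≤ (∑ vs (χ L₂)) (∑-mono vs V₀-dominated) ⟩
      ∑ vs (λ v → χ L₀ v * N L₂ v) + ∑ vs (χ L₂)
    ≡⟨ cong (_+ ∑ vs (χ L₂)) (double-count vs a a-sym (χ L₀) (χ L₂)) ⟩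
      ∑ vs (λ u → χ L₂ u * N L₀ u) + ∑ vs (χ L₂)
    ≡⟨ ≡.sym (∑-+ vs _ (χ L₂)) ⟩
      ∑ vs (λ u → χ L₂ u * N L₀ u + χ L₂ u)
    ≤⟨ ∑-mono vs V₂-bounded ⟩
      ∑ vs (λ u → χ L₂ u * Δ)
    ≡⟨ ∑-cong vs (λ u → ℕₚ.*-comm (χ L₂ u) Δ) ⟩
      ∑ vs (λ u → Δ * χ L₂ u)
    ≡⟨ ∑-*ˡ vs Δ (χ L₂) ⟩
      Δ * ∑ vs (χ L₂)
    ≡⟨ cong (Δ *_) (≡.sym (c≡∑χ L₂)) ⟩
      Δ * c L₂ ∎
    where open ℕₚ.≤-Reasoning

  order-bound : n ≤ Δ * c L₂ + c L₁
  order-bound = begin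
      n                        ≡⟨ order-split ⟩
      c L₀ + c L₁ + c L₂       ≡⟨ regroup (c L₀) (c L₁) (c L₂) ⟩
      (c L₀ + c L₂) + c L₁     ≤⟨ ℕₚ.+-monoˡ-≤ (c L₁) V₀+V₂≤Δ·V₂ ⟩
      Δ * c L₂ + c L₁          ∎
    where
    open ℕₚ.≤-Reasoning
    regroup : ∀ x y z → x + y + z ≡ (x + z) + y
    regroup = solve-∀

shift-identity : ∀ Δ m k → + (Δ * k + m) - (+ Δ - + 2) *ℤ + k ≡ + (m + 2 * k)
shift-identity Δ m k = begin
    + (Δ * k + m) - (+ Δ - + 2) *ℤ + k
  ≡⟨ cong (_- (+ Δ - + 2) *ℤ + k) (trans (ℤₚ.pos-+ (Δ * k) m) (cong (λ x → x ℤ.+ + m) (ℤₚ.pos-* Δ k))) ⟩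
    + Δ *ℤ + k ℤ.+ + m - (+ Δ - + 2) *ℤ + k
  ≡⟨ cancel (+ Δ) (+ m) (+ k) ⟩
    + m ℤ.+ + 2 *ℤ + k
  ≡⟨ ≡.sym (trans (ℤₚ.pos-+ m (2 * k)) (cong (ℤ._+_ (+ m)) (ℤₚ.pos-* 2 k))) ⟩
    + (m + 2 * k) ∎
  where
  open ≡-Reasoning
  cancel : ∀ (d x y : ℤ) → d *ℤ y ℤ.+ x - (d - + 2) *ℤ y ≡ x ℤ.+ + 2 *ℤ y
  cancel = ℤ-Ring.solve-∀

consequences : ∀ {n w} Δ m k → w ≡ m + 2 * k → n ≤ Δ * k + m →
    ((+ n) - ((+ Δ) - (+ 2)) *ℤ (+ k) ≤ℤ (+ w))
    × (n ≤ Δ * k + m)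
    × (n ≡ Δ * k + m → + w ≡ (+ n) - ((+ Δ) - (+ 2)) *ℤ (+ k))
consequences {n} Δ m k refl n≤ = lower-bound , n≤ , equality-case
  where
  lower-bound : + n - (+ Δ - + 2) *ℤ + k ≤ℤ + (m + 2 * k)
  lower-bound = subst (_ ≤ℤ_) (shift-identity Δ m k)
    (ℤₚ.+-monoˡ-≤ (ℤ.- ((+ Δ - + 2) *ℤ + k)) (ℤ.+≤+ n≤))
  equality-case : n ≡ Δ * k + m → + (m + 2 * k) ≡ + n - (+ Δ - + 2) *ℤ + k
  equality-case refl = ≡.sym (shift-identity Δ m k)

theorem13 : ∀ (n : ℕ) (G : Graph n) → NoIsolated G →
    ∀ (f : Labelling n) → IsGammaTRFunction G f →
      ((+ n) - ((+ maxDegree G) - (+ 2)) *ℤ (+ classSize f (suc (suc zero))) ≤ℤ (+ weight f))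
      × (n ≤ maxDegree G * classSize f (suc (suc zero)) + classSize f (suc zero))
      × (n ≡ maxDegree G * classSize f (suc (suc zero)) + classSize f (suc zero) →
          + weight f ≡ (+ n) - ((+ maxDegree G) - (+ 2)) *ℤ (+ classSize f (suc (suc zero))))
theorem13 n G _ f (trdf , _) = consequences Δ (c L₁) (c L₂) weight-split order-bound
  where open TRDFCounting G f trdf
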